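{- For any finite simple graph $G$, $\iota(\mathrm{Mid}(G))\ge \iota(G)$.
   Context: For a graph $H$ and $S\subseteq V(H)$, let $N_H[S]$ be $S$ together with all vertices adjacent to a vertex of $S$. A set $S\subseteq V(H)$ is an isolating set of $H$ if $V(H)\setminus N_H[S]$ is an independent set of $H$; $\iota(H)$ is the minimum size of an isolating set of $H$. The middle graph $\mathrm{Mid}(G)$ has vertex set $V(G)\cup\{m_e: e\in E(G)\}$, with $v\sim m_e$ iff $v$ is an endpoint of $e$, $m_e\sim m_f$ iff distinct edges $e,f$ share an endpoint, and no edges between vertices of $V(G)$. -}

module Defs where

open import Data.Nat using (ℕ; _≤_; _<_)
open import Data.Fin using (Fin; toℕ)
open import Data.Bool using (Bool; true; false)
open import Data.Product using (Σ; ∃; ∃-syntax; _×_; _,_; proj₁; proj₂)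
open import Data.Empty using (⊥)
open import Data.Sum using (_⊎_; inj₁; inj₂)
open import Data.List using (List; length)
open import Data.List.Membership.Propositional using (_∈_)
open import Data.List.Relation.Unary.Unique.Propositional using (Unique)
open import Relation.Nullary using (¬_)
open import Relation.Binary.PropositionalEquality using (_≡_; _≢_)

InClosedNbhd : {V : Set} (Adj : V → V → Set) (S : List V) (x : V) → Set
InClosedNbhd Adj S x = (x ∈ S) ⊎ (∃[ y ] (y ∈ S × Adj x y))

IsIsolatingSet : {V : Set} (Adj : V → V → Set) (S : List V) → Set
IsIsolatingSet Adj S =
  ∀ u v → ¬ InClosedNbhd Adj S u → ¬ InClosedNbhd Adj S v → ¬ Adj u v

IsIsolationNumber : {V : Set} (Adj : V → V → Set) (k : ℕ) → Set
IsIsolationNumber {V} Adj k =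
  (Σ (List V) λ S → Unique S × IsIsolatingSet Adj S × length S ≡ k)
  × (∀ (S : List V) → Unique S → IsIsolatingSet Adj S → k ≤ length S)

record SimpleGraph : Set where
  field
    n      : ℕ
    adj    : Fin n → Fin n → Bool
    sym    : ∀ u v → adj u v ≡ adj v u
    irrefl : ∀ v → adj v v ≡ false

open SimpleGraph public

Adj : (G : SimpleGraph) → Fin (n G) → Fin (n G) → Set
Adj G u v = adj G u v ≡ true

-- An edge {u,v} is represented uniquely as a pair (u , v) with u < v.
Edge : SimpleGraph → Set
Edge G = Σ (Fin (n G) × Fin (n G)) λ p →
  (toℕ (proj₁ p) < toℕ (proj₂ p)) × Adj G (proj₁ p) (proj₂ p)

IsEndpoint : (G : SimpleGraph) → Fin (n G) → Edge G → Set
IsEndpoint G v ((a , b) , _) = (v ≡ a) ⊎ (v ≡ b)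

ShareEndpoint : (G : SimpleGraph) → Edge G → Edge G → Set
ShareEndpoint G e f = ∃[ v ] (IsEndpoint G v e × IsEndpoint G v f)

MidVertex : SimpleGraph → Set
MidVertex G = Fin (n G) ⊎ Edge G

MidAdj : (G : SimpleGraph) → MidVertex G → MidVertex G → Set
MidAdj G (inj₁ u) (inj₁ v) = ⊥
MidAdj G (inj₁ v) (inj₂ e) = IsEndpoint G v e
MidAdj G (inj₂ e) (inj₁ v) = IsEndpoint G v e
MidAdj G (inj₂ e) (inj₂ f) = (e ≢ f) × ShareEndpoint G e f

-- Send every vertex of Mid(G) to a vertex of G: a vertex to itself, an edge to one
-- of its endpoints. If S isolates Mid(G), the image T of S isolates G: an edge uv
-- with u, v ∉ N_G[T] would give the vertex u and the edge vertex m_uv of Mid(G),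
-- adjacent and both outside N_Mid[S]. Since |T| ≤ |S|, ι(G) ≤ ι(Mid(G)).
module Submission where

open import Defs
open import Data.Nat using (ℕ; _≤_)
open import Data.Nat.Properties using (≤-trans; ≤-reflexive; <-cmp)
open import Data.Fin using (Fin; toℕ)
open import Data.Fin.Properties using (toℕ-injective; _≟_)
open import Data.Product using (Σ; ∃-syntax; _×_; _,_)
open import Data.Sum using (_⊎_; inj₁; inj₂)
open import Data.List using (List; length; map; deduplicate)
open import Data.List.Properties using (length-deduplicate; length-map)
open import Data.List.Membership.Propositional using (_∈_)
open import Data.List.Membership.Propositional.Properties using (∈-map⁺; ∈-deduplicate⁺)
open import Data.List.Relation.Unary.Unique.Propositional using (Unique)
open import Data.List.Relation.Unary.Unique.DecPropositional.Properties using (deduplicate-!)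
open import Relation.Nullary using (¬_)
open import Relation.Binary.PropositionalEquality as ≡ using (_≡_; refl; trans)
open import Relation.Binary.Definitions using (tri<; tri≈; tri>)

isolationNumber-mono :
  {V W : Set} {AdjV : V → V → Set} {AdjW : W → W → Set} {a b : ℕ} →
  (∀ S → IsIsolatingSet AdjV S →
     ∃[ T ] (Unique T × IsIsolatingSet AdjW T × length T ≤ length S)) →
  IsIsolationNumber AdjV a → IsIsolationNumber AdjW b → b ≤ a
isolationNumber-mono shrink ((S , _ , isoS , |S|≡a) , _) (_ , minimal)
  with shrink S isoS
... | T , uniqueT , isoT , |T|≤|S| =
  ≤-trans (minimal T uniqueT isoT) (≤-trans |T|≤|S| (≤-reflexive |S|≡a))

module _ (G : SimpleGraph) where

  Adj-irrefl : ∀ {v} → ¬ Adj G v v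
  Adj-irrefl {v} a with () ← trans (≡.sym a) (irrefl G v)

  Adj-sym : ∀ {u v} → Adj G u v → Adj G v u
  Adj-sym {u} {v} a = trans (SimpleGraph.sym G v u) a

  edge-between : ∀ {u v} → Adj G u v →
    Σ (Edge G) λ e → IsEndpoint G u e × (∀ w → IsEndpoint G w e → w ≡ u ⊎ w ≡ v)
  edge-between {u} {v} a with <-cmp (toℕ u) (toℕ v)
  ... | tri< u<v _ _ = ((u , v) , u<v , a) , inj₁ refl , λ _ w∈e → w∈e
  ... | tri≈ _ u≡v _ with refl ← toℕ-injective u≡v with () ← Adj-irrefl a
  ... | tri> _ _ v<u =
    ((v , u) , v<u , Adj-sym a) , inj₂ refl ,
    λ { _ (inj₁ w≡v) → inj₂ w≡v ; _ (inj₂ w≡u) → inj₁ w≡u }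

  anchor : MidVertex G → Fin (n G)
  anchor (inj₁ v) = v
  anchor (inj₂ ((x , _) , _)) = x

  anchor-endpoint : ∀ e → IsEndpoint G (anchor (inj₂ e)) e
  anchor-endpoint _ = inj₁ refl

  module _ (S : List (MidVertex G)) where

    anchors : List (Fin (n G))
    anchors = deduplicate _≟_ (map anchor S)

    anchors-unique : Unique anchors
    anchors-unique = deduplicate-! _≟_ (map anchor S)

    length-anchors : length anchors ≤ length S
    length-anchors =
      ≤-trans (length-deduplicate _≟_ (map anchor S)) (≤-reflexive (length-map anchor S))

    ∈-anchors : ∀ {s} → s ∈ S → anchor s ∈ anchors
    ∈-anchors s∈S = ∈-deduplicate⁺ _≟_ (∈-map⁺ anchor s∈S)

    vertex-outside : ∀ w → ¬ InClosedNbhd (Adj G) anchors w →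
      ¬ InClosedNbhd (MidAdj G) S (inj₁ w)
    vertex-outside w w∉N (inj₁ w∈S) = w∉N (inj₁ (∈-anchors w∈S))
    vertex-outside w w∉N (inj₂ (inj₂ f , f∈S , inj₁ refl)) = w∉N (inj₁ (∈-anchors f∈S))
    vertex-outside w w∉N (inj₂ (inj₂ ((x , _) , _ , axw) , f∈S , inj₂ refl)) =
      w∉N (inj₂ (x , ∈-anchors f∈S , Adj-sym axw))

    edge-outside : ∀ e → (∀ w → IsEndpoint G w e → ¬ InClosedNbhd (Adj G) anchors w) →
      ¬ InClosedNbhd (MidAdj G) S (inj₂ e)
    edge-outside e ends∉N (inj₁ e∈S) =
      vertex-outside _ (ends∉N _ x∈e) (inj₂ (inj₂ e , e∈S , x∈e))
      where x∈e = anchor-endpoint e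
    edge-outside e ends∉N (inj₂ (inj₁ w , w∈S , w∈e)) =
      vertex-outside w (ends∉N w w∈e) (inj₁ w∈S)
    edge-outside e ends∉N (inj₂ (inj₂ f , f∈S , _ , w , w∈e , w∈f)) =
      vertex-outside w (ends∉N w w∈e) (inj₂ (inj₂ f , f∈S , w∈f))

    anchors-isolating : IsIsolatingSet (MidAdj G) S → IsIsolatingSet (Adj G) anchors
    anchors-isolating isoS u v u∉N v∉N auv with edge-between auv
    ... | e , u∈e , ends =
      isoS (inj₁ u) (inj₂ e) (vertex-outside u u∉N) (edge-outside e ends∉N) u∈e
      where
      ends∉N : ∀ w → IsEndpoint G w e → ¬ InClosedNbhd (Adj G) anchors w
      ends∉N w w∈e with ends w w∈e
      ... | inj₁ refl = u∉N
      ... | inj₂ refl = v∉N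

proposition4 : (G : SimpleGraph) (a b : ℕ) →
    IsIsolationNumber (MidAdj G) a → IsIsolationNumber (Adj G) b → b ≤ a
proposition4 G a b =
  isolationNumber-mono λ S isoS →
    anchors G S , anchors-unique G S , anchors-isolating G S isoS , length-anchors G S
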